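{- Let $X\subseteq\omega$ and let $S\subseteq\omega$ be a $\Sigma^0_2(X)$ set with $S=[S]$. Then there is a $\Pi^0_1(X)$ set $T\subseteq\omega$ with $[T]=[S]=S$.
   Context: A ceer is a computably enumerable equivalence relation on $\omega$. Let $(E_i)_{i\in\omega}$ be a standard effective uniform enumeration of all ceers (obtained from a standard enumeration of c.e. sets, so that each ceer has infinitely many indices obtainable by computable padding). For equivalence relations $E,F$ on $\omega$, $E\le F$ if there is a total computable $\Phi$ with $i\mathrel{E}j\iff\Phi(i)\mathrel{F}\Phi(j)$; $E\equiv F$ means $E\le F$ and $F\le E$. For $S\subseteq\omega$, $[S]=\{i\mid \exists j\in S\,(E_i\equiv E_j)\}$. -}

module Defs where

open import Data.Nat using (ℕ; zero; suc; _+_)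
open import Data.Bool using (Bool; true; false; if_then_else_)
open import Data.Maybe using (Maybe; just; nothing)
open import Data.Product using (Σ; _×_; _,_; proj₁; proj₂; ∃)
open import Function.Bundles using (_⇔_)
open import Relation.Nullary using (¬_)
open import Relation.Binary.PropositionalEquality using (_≡_)

tri : ℕ → ℕ
tri zero    = zero
tri (suc k) = suc k + tri k

pair : ℕ → ℕ → ℕ
pair a b = tri (a + b) + a

nextPair : ℕ × ℕ → ℕ × ℕ
nextPair (a , zero)  = (zero , suc a)
nextPair (a , suc b) = (suc a , b)

unpair : ℕ → ℕ × ℕ
unpair zero    = (zero , zero)
unpair (suc n) = nextPair (unpair n)

-- Oracle μ-recursive functions (unary, using pairing), a standard
-- Turing-complete model of computation relative to an oracle.

data Code : Set where
  Zᶜ Sᶜ Iᶜ Oᶜ P₁ P₂ : Code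
  Pair Comp Rec : Code → Code → Code
  Mu            : Code → Code

decode : ℕ → ℕ → Code
decode zero    n = Zᶜ
decode (suc f) n with unpair n
... | (0 , r) = Zᶜ
... | (1 , r) = Sᶜ
... | (2 , r) = Iᶜ
... | (3 , r) = Oᶜ
... | (4 , r) = P₁
... | (5 , r) = P₂
... | (6 , r) = Pair (decode f (proj₁ (unpair r))) (decode f (proj₂ (unpair r)))
... | (7 , r) = Comp (decode f (proj₁ (unpair r))) (decode f (proj₂ (unpair r)))
... | (8 , r) = Rec  (decode f (proj₁ (unpair r))) (decode f (proj₂ (unpair r)))
... | (9 , r) = Mu (decode f r)
... | (_ , r) = Zᶜ

code : ℕ → Code
code n = decode (suc n) n

Oracle : Set
Oracle = ℕ → Bool

-- the empty oracle (unrelativized computation)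
∅ : Oracle
∅ _ = false

-- fuel-bounded evaluation of Φ_c^X(n)
mutual
  eval : ℕ → Oracle → Code → ℕ → Maybe ℕ
  eval zero    X c n = nothing
  eval (suc k) X Zᶜ n = just zero
  eval (suc k) X Sᶜ n = just (suc n)
  eval (suc k) X Iᶜ n = just n
  eval (suc k) X Oᶜ n = just (if X n then 1 else 0)
  eval (suc k) X P₁ n = just (proj₁ (unpair n))
  eval (suc k) X P₂ n = just (proj₂ (unpair n))
  eval (suc k) X (Pair f g) n with eval k X f n | eval k X g n
  ... | just a | just b = just (pair a b)
  ... | _      | _      = nothing
  eval (suc k) X (Comp f g) n with eval k X g n
  ... | just b  = eval k X f b
  ... | nothing = nothing
  eval (suc k) X (Rec f g) n with unpair n
  ... | (x , zero)  = eval k X f x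
  ... | (x , suc y) with eval k X (Rec f g) (pair x y)
  ...   | just h  = eval k X g (pair (pair x y) h)
  ...   | nothing = nothing
  eval (suc k) X (Mu f) n = search k X f n zero

  search : ℕ → Oracle → Code → ℕ → ℕ → Maybe ℕ
  search zero    X f x i = nothing
  search (suc k) X f x i with eval k X f (pair x i)
  ... | just zero    = just i
  ... | just (suc _) = search k X f x (suc i)
  ... | nothing      = nothing

Halts : Oracle → ℕ → ℕ → Set
Halts X e n = Σ ℕ λ s → Σ ℕ λ y → eval s X (code e) n ≡ just y

Pred : Set₁
Pred = ℕ → Set

Π⁰₁ : Oracle → Pred → Set
Π⁰₁ X T = Σ ℕ λ e → ∀ n → (T n ⇔ (¬ Halts X e n))

Σ⁰₂ : Oracle → Pred → Set
Σ⁰₂ X S = Σ ℕ λ e → ∀ n → (S n ⇔ ∃ λ a → ¬ Halts X e (pair n a))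

-- Ceers: E_i is the equivalence relation generated by W_i
-- (W_i viewed as a set of pairs via the pairing function)

data E (i : ℕ) : ℕ → ℕ → Set where
  gen  : ∀ {a b} → Halts ∅ i (pair a b) → E i a b
  rfl  : ∀ {a} → E i a a
  sym  : ∀ {a b} → E i a b → E i b a
  trns : ∀ {a b c} → E i a b → E i b c → E i a c

Rel : Set₁
Rel = ℕ → ℕ → Set

_≤ᶜ_ : Rel → Rel → Set
R ≤ᶜ F = Σ ℕ λ e → Σ (ℕ → ℕ) λ f →
           (∀ n → Σ ℕ λ s → eval s ∅ (code e) n ≡ just (f n)) ×
           (∀ i j → (R i j ⇔ F (f i) (f j)))

_≡ᶜ_ : Rel → Rel → Set
R ≡ᶜ F = (R ≤ᶜ F) × (F ≤ᶜ R)

[_] : Pred → Pred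
[ S ] i = Σ ℕ λ j → S j × (E i ≡ᶜ E j)

{-# OPTIONS --safe #-}
module Submission where

-- Fix e with  S n ⇔ ∃ a. ⟨n,a⟩ ∉ W_e^X.  For every a, the number pad n a is an index of the
-- composition Φ_n ∘ id, so it halts where n halts and E_(pad n a) = E_n; and (n , a) can be
-- computed back from pad n a.  Let unpad (pad n a) = ⟨n,a⟩ and unpad m = ⟨m,0⟩ when m is not a
-- padded index; then T = { m ∣ unpad m ∉ W_e^X } is Π⁰₁(X).  A witness a for n ∈ S puts pad n a
-- into T, and every m ∈ T has the same ceer as some element of S: n if m = pad n a, and otherwise
-- m itself, with witness 0.

open import Defs
open import Data.Product using (Σ; _×_)
open import Function.Bundles using (_⇔_)

open import Data.Nat
open import Data.Nat.Properties
open import Data.Maybe using (just)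
open import Data.Maybe.Properties using (just-injective)
open import Data.Product using (_,_; proj₁; proj₂; uncurry)
open import Function.Base using (_∘_; id; const)
open import Function.Bundles using (mk⇔; Equivalence)
open import Function.Properties.Equivalence using ()
  renaming (refl to ⇔-refl; sym to ⇔-sym; trans to ⇔-trans)
open import Relation.Nullary using (¬_)
open import Relation.Binary.PropositionalEquality as ≡
  using (_≡_; refl; trans; cong; cong₂; subst; _≗_; module ≡-Reasoning)

open Equivalence using (to; from)

pair[1+m,n]≡1+pair[m,1+n] : ∀ m n → pair (suc m) n ≡ suc (pair m (suc n))
pair[1+m,n]≡1+pair[m,1+n] m n rewrite +-suc m n | +-suc (tri (suc (m + n))) m = refl

pair[0,1+n]≡1+pair[n,0] : ∀ n → pair 0 (suc n) ≡ suc (pair n 0)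
pair[0,1+n]≡1+pair[n,0] n rewrite +-identityʳ n | +-identityʳ (n + tri n) | +-comm n (tri n) = refl

pair-nextPair : ∀ p → uncurry pair (nextPair p) ≡ suc (uncurry pair p)
pair-nextPair (m , zero)  = pair[0,1+n]≡1+pair[n,0] m
pair-nextPair (m , suc n) = pair[1+m,n]≡1+pair[m,1+n] m n

pair-unpair : ∀ n → uncurry pair (unpair n) ≡ n
pair-unpair zero    = refl
pair-unpair (suc n) = trans (pair-nextPair (unpair n)) (cong suc (pair-unpair n))

unpair-pair : ∀ m n → unpair (pair m n) ≡ (m , n)
unpair-pair m n = go (m + n) m n refl
  where
  go : ∀ s m n → m + n ≡ s → unpair (pair m n) ≡ (m , n)
  go s       zero    zero    _  = refl
  go s       (suc m) n       eq = trans (cong unpair (pair[1+m,n]≡1+pair[m,1+n] m n))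
    (cong nextPair (go s m (suc n) (trans (+-suc m n) eq)))
  go (suc s) zero    (suc n) eq = trans (cong unpair (pair[0,1+n]≡1+pair[n,0] n))
    (cong nextPair (go s n zero (trans (+-identityʳ n) (suc-injective eq))))

unpair≡⇒≡pair : ∀ {k m n} → unpair k ≡ (m , n) → k ≡ pair m n
unpair≡⇒≡pair {k} eq = trans (≡.sym (pair-unpair k)) (cong (uncurry pair) eq)

unpair₁ unpair₂ : ℕ → ℕ
unpair₁ = proj₁ ∘ unpair
unpair₂ = proj₂ ∘ unpair

unpair₁-pair : ∀ m n → unpair₁ (pair m n) ≡ m
unpair₁-pair m n = cong proj₁ (unpair-pair m n)

unpair₂-pair : ∀ m n → unpair₂ (pair m n) ≡ n
unpair₂-pair m n = cong proj₂ (unpair-pair m n)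

n≤tri[n] : ∀ n → n ≤ tri n
n≤tri[n] zero    = z≤n
n≤tri[n] (suc n) = m≤m+n (suc n) (tri n)

m+n≤pair[m,n] : ∀ m n → m + n ≤ pair m n
m+n≤pair[m,n] m n = ≤-trans (n≤tri[n] (m + n)) (m≤m+n (tri (m + n)) m)

m≤pair[m,n] : ∀ m n → m ≤ pair m n
m≤pair[m,n] m n = ≤-trans (m≤m+n m n) (m+n≤pair[m,n] m n)

n≤pair[m,n] : ∀ m n → n ≤ pair m n
n≤pair[m,n] m n = ≤-trans (m≤n+m n m) (m+n≤pair[m,n] m n)

n<pair[1+k,n] : ∀ k n → n < pair (suc k) n
n<pair[1+k,n] k n = ≤-trans (s≤s (m≤n+m n k)) (m+n≤pair[m,n] (suc k) n)

unpair₁[n]≤n : ∀ n → unpair₁ n ≤ n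
unpair₁[n]≤n n = subst (unpair₁ n ≤_) (pair-unpair n) (m≤pair[m,n] (unpair₁ n) (unpair₂ n))

unpair₂[n]≤n : ∀ n → unpair₂ n ≤ n
unpair₂[n]≤n n = subst (unpair₂ n ≤_) (pair-unpair n) (n≤pair[m,n] (unpair₁ n) (unpair₂ n))

unpair≡[1+k,r]⇒r< : ∀ {n k r} → unpair n ≡ (suc k , r) → r < n
unpair≡[1+k,r]⇒r< {k = k} {r} eq = subst (r <_) (≡.sym (unpair≡⇒≡pair eq)) (n<pair[1+k,n] k r)

decode-step-stable : ∀ f f′ x → (∀ {a} → a < x → decode f a ≡ decode f′ a) →
                     decode (suc f) x ≡ decode (suc f′) x
decode-step-stable f f′ x ih with unpair x in eq
... | (0 , r) = refl
... | (1 , r) = refl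
... | (2 , r) = refl
... | (3 , r) = refl
... | (4 , r) = refl
... | (5 , r) = refl
... | (6 , r) = cong₂ Pair (ih (≤-<-trans (unpair₁[n]≤n r) (unpair≡[1+k,r]⇒r< eq)))
                          (ih (≤-<-trans (unpair₂[n]≤n r) (unpair≡[1+k,r]⇒r< eq)))
... | (7 , r) = cong₂ Comp (ih (≤-<-trans (unpair₁[n]≤n r) (unpair≡[1+k,r]⇒r< eq)))
                          (ih (≤-<-trans (unpair₂[n]≤n r) (unpair≡[1+k,r]⇒r< eq)))
... | (8 , r) = cong₂ Rec (ih (≤-<-trans (unpair₁[n]≤n r) (unpair≡[1+k,r]⇒r< eq)))
                         (ih (≤-<-trans (unpair₂[n]≤n r) (unpair≡[1+k,r]⇒r< eq)))
... | (9 , r) = cong Mu (ih (unpair≡[1+k,r]⇒r< eq))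
... | (suc (suc (suc (suc (suc (suc (suc (suc (suc (suc _))))))))) , r) = refl

decode-stable : ∀ {f f′ x} → x < f → x < f′ → decode f x ≡ decode f′ x
decode-stable {suc f} {suc f′} {x} (s≤s x≤f) (s≤s x≤f′) =
  decode-step-stable f f′ x (λ a<x → decode-stable (<-≤-trans a<x x≤f) (<-≤-trans a<x x≤f′))

decode-code : ∀ {f x} → x < f → decode f x ≡ code x
decode-code {x = x} x<f = decode-stable x<f (n<1+n x)

decode-Pair : ∀ f a b → decode (suc f) (pair 6 (pair a b)) ≡ Pair (decode f a) (decode f b)
decode-Pair f a b rewrite unpair-pair 6 (pair a b) | unpair-pair a b = refl

decode-Comp : ∀ f a b → decode (suc f) (pair 7 (pair a b)) ≡ Comp (decode f a) (decode f b)
decode-Comp f a b rewrite unpair-pair 7 (pair a b) | unpair-pair a b = refl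

decode-Rec : ∀ f a b → decode (suc f) (pair 8 (pair a b)) ≡ Rec (decode f a) (decode f b)
decode-Rec f a b rewrite unpair-pair 8 (pair a b) | unpair-pair a b = refl

decode-Mu : ∀ f a → decode (suc f) (pair 9 a) ≡ Mu (decode f a)
decode-Mu f a rewrite unpair-pair 9 a = refl

decode-child₁ : ∀ k a b {c} → code a ≡ c → decode (pair (suc k) (pair a b)) a ≡ c
decode-child₁ k a b = trans (decode-code (≤-<-trans (m≤pair[m,n] a b) (n<pair[1+k,n] k _)))

decode-child₂ : ∀ k a b {c} → code b ≡ c → decode (pair (suc k) (pair a b)) b ≡ c
decode-child₂ k a b = trans (decode-code (≤-<-trans (n≤pair[m,n] a b) (n<pair[1+k,n] k _)))

index : Code → ℕ
index Zᶜ         = pair 0 0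
index Sᶜ         = pair 1 0
index Iᶜ         = pair 2 0
index Oᶜ         = pair 3 0
index P₁         = pair 4 0
index P₂         = pair 5 0
index (Pair f g) = pair 6 (pair (index f) (index g))
index (Comp f g) = pair 7 (pair (index f) (index g))
index (Rec f g)  = pair 8 (pair (index f) (index g))
index (Mu f)     = pair 9 (index f)

code-index : ∀ c → code (index c) ≡ c
code-index Zᶜ         = refl
code-index Sᶜ         = refl
code-index Iᶜ         = refl
code-index Oᶜ         = refl
code-index P₁         = refl
code-index P₂         = refl
code-index (Pair f g) = trans (decode-Pair (index (Pair f g)) (index f) (index g))
  (cong₂ Pair (decode-child₁ 5 (index f) (index g) (code-index f))
              (decode-child₂ 5 (index f) (index g) (code-index g)))
code-index (Comp f g) = trans (decode-Comp (index (Comp f g)) (index f) (index g))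
  (cong₂ Comp (decode-child₁ 6 (index f) (index g) (code-index f))
              (decode-child₂ 6 (index f) (index g) (code-index g)))
code-index (Rec f g)  = trans (decode-Rec (index (Rec f g)) (index f) (index g))
  (cong₂ Rec (decode-child₁ 7 (index f) (index g) (code-index f))
             (decode-child₂ 7 (index f) (index g) (code-index g)))
code-index (Mu f)     = trans (decode-Mu (index (Mu f)) (index f))
  (cong Mu (trans (decode-code (n<pair[1+k,n] 8 (index f))) (code-index f)))

code[pair[2,a]]≡Iᶜ : ∀ a → code (pair 2 a) ≡ Iᶜ
code[pair[2,a]]≡Iᶜ a rewrite unpair-pair 2 a = refl

-- The parameter a is dead weight: pair 2 a decodes to Iᶜ whatever a is.
pad : ℕ → ℕ → ℕ
pad n a = pair 7 (pair n (pair 2 a))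

code-pad : ∀ n a → code (pad n a) ≡ Comp (code n) Iᶜ
code-pad n a = trans (decode-Comp (pad n a) n (pair 2 a))
  (cong₂ Comp (decode-child₁ 6 n (pair 2 a) refl)
              (decode-child₂ 6 n (pair 2 a) (code[pair[2,a]]≡Iᶜ a)))

Haltsᶜ : Oracle → Code → ℕ → Set
Haltsᶜ X c n = Σ ℕ λ s → Σ ℕ λ y → eval s X c n ≡ just y

Halts⇔Haltsᶜ : ∀ {X e c} → code e ≡ c → ∀ n → Halts X e n ⇔ Haltsᶜ X c n
Halts⇔Haltsᶜ refl n = ⇔-refl

primRec : (ℕ → ℕ) → (ℕ → ℕ) → ℕ → ℕ → ℕ
primRec F G x zero    = F x
primRec F G x (suc y) = G (pair (pair x y) (primRec F G x y))

module Evaluation (X : Oracle) where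

  mutual
    eval-suc : ∀ k c n {y} → eval k X c n ≡ just y → eval (suc k) X c n ≡ just y
    eval-suc (suc k) Zᶜ n e = e
    eval-suc (suc k) Sᶜ n e = e
    eval-suc (suc k) Iᶜ n e = e
    eval-suc (suc k) Oᶜ n e = e
    eval-suc (suc k) P₁ n e = e
    eval-suc (suc k) P₂ n e = e
    eval-suc (suc k) (Pair f g) n e with eval k X f n in ef | eval k X g n in eg
    ... | just a | just b rewrite eval-suc k f n ef | eval-suc k g n eg = e
    eval-suc (suc k) (Comp f g) n e with eval k X g n in eg
    ... | just b rewrite eval-suc k g n eg = eval-suc k f b e
    eval-suc (suc k) (Rec f g) n e with unpair n
    ... | (x , zero)  = eval-suc k f x e
    ... | (x , suc y) with eval k X (Rec f g) (pair x y) in eh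
    ...   | just h rewrite eval-suc k (Rec f g) (pair x y) eh = eval-suc k g _ e
    eval-suc (suc k) (Mu f) n e = search-suc k f n 0 e

    search-suc : ∀ k f x i {y} → search k X f x i ≡ just y → search (suc k) X f x i ≡ just y
    search-suc (suc k) f x i e with eval k X f (pair x i) in ef
    ... | just zero    rewrite eval-suc k f _ ef = e
    ... | just (suc _) rewrite eval-suc k f _ ef = search-suc k f x (suc i) e

  eval-mono : ∀ {k k′} c n {y} → k ≤ k′ → eval k X c n ≡ just y → eval k′ X c n ≡ just y
  eval-mono {k} c n {y} k≤k′ e with m≤n⇒∃[o]m+o≡n k≤k′
  ... | (o , refl) = go o
    where
    go : ∀ o → eval (k + o) X c n ≡ just y
    go zero    rewrite +-identityʳ k = e
    go (suc o) rewrite +-suc k o = eval-suc (k + o) c n (go o)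

  eval-det : ∀ {k k′} c n {y y′} → eval k X c n ≡ just y → eval k′ X c n ≡ just y′ → y ≡ y′
  eval-det {k} {k′} c n e e′ =
    just-injective (trans (≡.sym (eval-mono c n (m≤m⊔n k k′) e)) (eval-mono c n (m≤n⊔m k k′) e′))

  eval-Pair : ∀ k f g n {a b} → eval k X f n ≡ just a → eval k X g n ≡ just b →
              eval (suc k) X (Pair f g) n ≡ just (pair a b)
  eval-Pair k f g n ef eg rewrite ef | eg = refl

  eval-Comp : ∀ k f g n {b} → eval k X g n ≡ just b → eval (suc k) X (Comp f g) n ≡ eval k X f b
  eval-Comp k f g n eg rewrite eg = refl

  eval-Rec-zero : ∀ k f g x → eval (suc k) X (Rec f g) (pair x zero) ≡ eval k X f x
  eval-Rec-zero k f g x rewrite unpair-pair x zero = refl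

  eval-Rec-suc : ∀ k f g x y {h} → eval k X (Rec f g) (pair x y) ≡ just h →
                 eval (suc k) X (Rec f g) (pair x (suc y)) ≡ eval k X g (pair (pair x y) h)
  eval-Rec-suc k f g x y er rewrite unpair-pair x (suc y) | er = refl

  Computes : Code → (ℕ → ℕ) → Set
  Computes c F = ∀ n → Σ ℕ λ k → eval k X c n ≡ just (F n)

  computes-≗ : ∀ {c F G} → F ≗ G → Computes c F → Computes c G
  computes-≗ F≗G hc n with hc n
  ... | (k , e) = k , trans e (cong just (F≗G n))

  Zᶜ-computes : Computes Zᶜ (const 0)
  Zᶜ-computes n = 1 , refl

  Sᶜ-computes : Computes Sᶜ suc
  Sᶜ-computes n = 1 , refl

  Iᶜ-computes : Computes Iᶜ id
  Iᶜ-computes n = 1 , refl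

  P₁-computes : Computes P₁ unpair₁
  P₁-computes n = 1 , refl

  P₂-computes : Computes P₂ unpair₂
  P₂-computes n = 1 , refl

  Pair-computes : ∀ {f g F G} → Computes f F → Computes g G →
                  Computes (Pair f g) (λ n → pair (F n) (G n))
  Pair-computes {f} {g} hf hg n with hf n | hg n
  ... | (k , ef) | (k′ , eg) = suc (k ⊔ k′) ,
    eval-Pair (k ⊔ k′) f g n (eval-mono f n (m≤m⊔n k k′) ef) (eval-mono g n (m≤n⊔m k k′) eg)

  Comp-computes : ∀ {f g F G} → Computes f F → Computes g G → Computes (Comp f g) (F ∘ G)
  Comp-computes {f} {g} {G = G} hf hg n with hg n | hf (G n)
  ... | (k , eg) | (k′ , ef) = suc (k ⊔ k′) ,
    trans (eval-Comp (k ⊔ k′) f g n (eval-mono g n (m≤m⊔n k k′) eg))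
          (eval-mono f (G n) (m≤n⊔m k k′) ef)

  Rec-computes-pair : ∀ {f g F G} → Computes f F → Computes g G →
                      ∀ x y → Σ ℕ λ k → eval k X (Rec f g) (pair x y) ≡ just (primRec F G x y)
  Rec-computes-pair {f} {g} hf hg x zero with hf x
  ... | (k , ef) = suc k , trans (eval-Rec-zero k f g x) ef
  Rec-computes-pair {f} {g} {F} {G} hf hg x (suc y)
    with Rec-computes-pair hf hg x y | hg (pair (pair x y) (primRec F G x y))
  ... | (k , er) | (k′ , eg) = suc (k ⊔ k′) ,
    trans (eval-Rec-suc (k ⊔ k′) f g x y (eval-mono (Rec f g) (pair x y) (m≤m⊔n k k′) er))
          (eval-mono g _ (m≤n⊔m k k′) eg)

  Rec-computes : ∀ {f g F G} → Computes f F → Computes g G →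
                 Computes (Rec f g) (uncurry (primRec F G) ∘ unpair)
  Rec-computes {f} {g} {F} {G} hf hg n =
    subst (λ m → Σ ℕ λ k → eval k X (Rec f g) m ≡ just (uncurry (primRec F G) (unpair n)))
          (pair-unpair n) (Rec-computes-pair hf hg (unpair₁ n) (unpair₂ n))

  halts-Comp : ∀ {f g G} → Computes g G → ∀ n → Haltsᶜ X (Comp f g) n ⇔ Haltsᶜ X f (G n)
  halts-Comp {f} {g} {G} hg n = mk⇔ split join
    where
    split : Haltsᶜ X (Comp f g) n → Haltsᶜ X f (G n)
    split (suc s , y , e) with eval s X g n in eg | hg n
    ... | just b | (k , eG) with eval-det {s} {k} g n eg eG
    ...   | refl = s , y , e
    join : Haltsᶜ X f (G n) → Haltsᶜ X (Comp f g) n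
    join (s , y , e) with hg n
    ... | (k , eG) = suc (s ⊔ k) , y ,
      trans (eval-Comp (s ⊔ k) f g n (eval-mono g n (m≤n⊔m s k) eG))
            (eval-mono f (G n) (m≤m⊔n s k) e)

constᶜ : ℕ → Code
constᶜ zero    = Zᶜ
constᶜ (suc k) = Comp Sᶜ (constᶜ k)

primRecᶜ : Code → Code → Code → Code → Code
primRecᶜ f g a b = Comp (Rec f g) (Pair a b)

predᶜ : Code
predᶜ = primRecᶜ Zᶜ (Comp P₂ P₁) Zᶜ Iᶜ

_∸ᶜ_ _+ᶜ_ ∣_-_∣ᶜ : Code → Code → Code
f ∸ᶜ g = primRecᶜ Iᶜ (Comp predᶜ P₂) f g
f +ᶜ g = primRecᶜ Iᶜ (Comp Sᶜ P₂) f g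
∣ f - g ∣ᶜ = (f ∸ᶜ g) +ᶜ (g ∸ᶜ f)

ifZero : ℕ → ℕ → ℕ → ℕ
ifZero zero    u v = u
ifZero (suc _) u v = v

ifZeroᶜ : Code → Code → Code → Code
ifZeroᶜ c u v = primRecᶜ P₁ (Comp P₂ (Comp P₁ P₁)) (Pair u v) c

primRec-pred : ∀ y → primRec (const 0) (unpair₂ ∘ unpair₁) 0 y ≡ pred y
primRec-pred zero    = refl
primRec-pred (suc y) = trans (cong unpair₂ (unpair₁-pair (pair 0 y) _)) (unpair₂-pair 0 y)

primRec-∸ : ∀ x y → primRec id (pred ∘ unpair₂) x y ≡ x ∸ y
primRec-∸ x zero    = refl
primRec-∸ x (suc y) = begin
  pred (unpair₂ (pair (pair x y) r)) ≡⟨ cong pred (unpair₂-pair (pair x y) r) ⟩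
  pred r                             ≡⟨ cong pred (primRec-∸ x y) ⟩
  pred (x ∸ y)                       ≡⟨ pred[m∸n]≡m∸[1+n] x y ⟩
  x ∸ suc y                          ∎
  where
  open ≡-Reasoning
  r = primRec id (pred ∘ unpair₂) x y

primRec-+ : ∀ x y → primRec id (suc ∘ unpair₂) x y ≡ x + y
primRec-+ x zero    = ≡.sym (+-identityʳ x)
primRec-+ x (suc y) = begin
  suc (unpair₂ (pair (pair x y) r)) ≡⟨ cong suc (unpair₂-pair (pair x y) r) ⟩
  suc r                             ≡⟨ cong suc (primRec-+ x y) ⟩
  suc (x + y)                       ≡⟨ +-suc x y ⟨
  x + suc y                         ∎
  where
  open ≡-Reasoning
  r = primRec id (suc ∘ unpair₂) x y

primRec-ifZero : ∀ u v c → primRec unpair₁ (unpair₂ ∘ unpair₁ ∘ unpair₁) (pair u v) c ≡ ifZero c u v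
primRec-ifZero u v zero    = unpair₁-pair u v
primRec-ifZero u v (suc c) = begin
  unpair₂ (unpair₁ (unpair₁ (pair w r))) ≡⟨ cong (unpair₂ ∘ unpair₁) (unpair₁-pair w r) ⟩
  unpair₂ (unpair₁ w)                    ≡⟨ cong unpair₂ (unpair₁-pair (pair u v) c) ⟩
  unpair₂ (pair u v)                     ≡⟨ unpair₂-pair u v ⟩
  v                                      ∎
  where
  open ≡-Reasoning
  w = pair (pair u v) c
  r = primRec unpair₁ (unpair₂ ∘ unpair₁ ∘ unpair₁) (pair u v) c

∣m-n∣≡m∸n+n∸m : ∀ m n → ∣ m - n ∣ ≡ (m ∸ n) + (n ∸ m)
∣m-n∣≡m∸n+n∸m zero    n       = ≡.sym (cong (_+ n) (0∸n≡0 n))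
∣m-n∣≡m∸n+n∸m (suc m) zero    = ≡.sym (+-identityʳ (suc m))
∣m-n∣≡m∸n+n∸m (suc m) (suc n) = ∣m-n∣≡m∸n+n∸m m n

module Arithmetic (X : Oracle) where
  open Evaluation X

  constᶜ-computes : ∀ k → Computes (constᶜ k) (const k)
  constᶜ-computes zero    = Zᶜ-computes
  constᶜ-computes (suc k) = Comp-computes Sᶜ-computes (constᶜ-computes k)

  primRecᶜ-computes : ∀ {f g a b F G A B} →
                      Computes f F → Computes g G → Computes a A → Computes b B →
                      Computes (primRecᶜ f g a b) (λ n → primRec F G (A n) (B n))
  primRecᶜ-computes {F = F} {G} {A} {B} hf hg ha hb =
    computes-≗ (λ n → cong (uncurry (primRec F G)) (unpair-pair (A n) (B n)))
               (Comp-computes (Rec-computes hf hg) (Pair-computes ha hb))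

  predᶜ-computes : Computes predᶜ pred
  predᶜ-computes = computes-≗ primRec-pred
    (primRecᶜ-computes Zᶜ-computes (Comp-computes P₂-computes P₁-computes) Zᶜ-computes Iᶜ-computes)

  ∸ᶜ-computes : ∀ {f g F G} → Computes f F → Computes g G → Computes (f ∸ᶜ g) (λ n → F n ∸ G n)
  ∸ᶜ-computes {F = F} {G} hf hg = computes-≗ (λ n → primRec-∸ (F n) (G n))
    (primRecᶜ-computes Iᶜ-computes (Comp-computes predᶜ-computes P₂-computes) hf hg)

  +ᶜ-computes : ∀ {f g F G} → Computes f F → Computes g G → Computes (f +ᶜ g) (λ n → F n + G n)
  +ᶜ-computes {F = F} {G} hf hg = computes-≗ (λ n → primRec-+ (F n) (G n))
    (primRecᶜ-computes Iᶜ-computes (Comp-computes Sᶜ-computes P₂-computes) hf hg)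

  ∣-∣ᶜ-computes : ∀ {f g F G} → Computes f F → Computes g G →
                  Computes ∣ f - g ∣ᶜ (λ n → ∣ F n - G n ∣)
  ∣-∣ᶜ-computes {F = F} {G} hf hg = computes-≗ (λ n → ≡.sym (∣m-n∣≡m∸n+n∸m (F n) (G n)))
    (+ᶜ-computes (∸ᶜ-computes hf hg) (∸ᶜ-computes hg hf))

  ifZeroᶜ-computes : ∀ {c u v C U V} → Computes c C → Computes u U → Computes v V →
                     Computes (ifZeroᶜ c u v) (λ n → ifZero (C n) (U n) (V n))
  ifZeroᶜ-computes {C = C} {U} {V} hc hu hv = computes-≗ (λ n → primRec-ifZero (U n) (V n) (C n))
    (primRecᶜ-computes P₁-computes (Comp-computes P₂-computes (Comp-computes P₁-computes P₁-computes))
                       (Pair-computes hu hv) hc)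

padBase padAmount : ℕ → ℕ
padBase   = unpair₁ ∘ unpair₂
padAmount = unpair₂ ∘ unpair₂ ∘ unpair₂

padBase-pad : ∀ n a → padBase (pad n a) ≡ n
padBase-pad n a = trans (cong unpair₁ (unpair₂-pair 7 (pair n (pair 2 a)))) (unpair₁-pair n (pair 2 a))

padAmount-pad : ∀ n a → padAmount (pad n a) ≡ a
padAmount-pad n a = begin
  unpair₂ (unpair₂ (unpair₂ (pad n a))) ≡⟨ cong (unpair₂ ∘ unpair₂) (unpair₂-pair 7 (pair n (pair 2 a))) ⟩
  unpair₂ (unpair₂ (pair n (pair 2 a))) ≡⟨ cong unpair₂ (unpair₂-pair n (pair 2 a)) ⟩
  unpair₂ (pair 2 a)                    ≡⟨ unpair₂-pair 2 a ⟩
  a                                     ∎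
  where open ≡-Reasoning

unpad : ℕ → ℕ
unpad m = ifZero ∣ m - pad (padBase m) (padAmount m) ∣ (pair (padBase m) (padAmount m)) (pair m 0)

unpad-pad : ∀ n a → unpad (pad n a) ≡ pair n a
unpad-pad n a = begin
  unpad m                                ≡⟨ cong₂ unpadAs (padBase-pad n a) (padAmount-pad n a) ⟩
  ifZero ∣ m - m ∣ (pair n a) (pair m 0) ≡⟨ cong (λ d → ifZero d (pair n a) (pair m 0)) (∣n-n∣≡0 m) ⟩
  pair n a                               ∎
  where
  open ≡-Reasoning
  m = pad n a
  unpadAs : ℕ → ℕ → ℕ
  unpadAs n′ a′ = ifZero ∣ m - pad n′ a′ ∣ (pair n′ a′) (pair m 0)

padᶜ : Code → Code → Code
padᶜ f g = Pair (constᶜ 7) (Pair f (Pair (constᶜ 2) g))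

padBaseᶜ padAmountᶜ unpadᶜ : Code
padBaseᶜ   = Comp P₁ P₂
padAmountᶜ = Comp P₂ (Comp P₂ P₂)
unpadᶜ     = ifZeroᶜ ∣ Iᶜ - padᶜ padBaseᶜ padAmountᶜ ∣ᶜ (Pair padBaseᶜ padAmountᶜ) (Pair Iᶜ Zᶜ)

unpadᶜ-computes : ∀ X → Evaluation.Computes X unpadᶜ unpad
unpadᶜ-computes X =
  ifZeroᶜ-computes (∣-∣ᶜ-computes Iᶜ-computes (padᶜ-computes padBaseᶜ-computes padAmountᶜ-computes))
                   (Pair-computes padBaseᶜ-computes padAmountᶜ-computes)
                   (Pair-computes Iᶜ-computes Zᶜ-computes)
  where
  open Evaluation X
  open Arithmetic X
  padBaseᶜ-computes : Computes padBaseᶜ padBase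
  padBaseᶜ-computes = Comp-computes P₁-computes P₂-computes
  padAmountᶜ-computes : Computes padAmountᶜ padAmount
  padAmountᶜ-computes = Comp-computes P₂-computes (Comp-computes P₂-computes P₂-computes)
  padᶜ-computes : ∀ {f g F G} → Computes f F → Computes g G →
                  Computes (padᶜ f g) (λ n → pad (F n) (G n))
  padᶜ-computes hf hg =
    Pair-computes (constᶜ-computes 7) (Pair-computes hf (Pair-computes (constᶜ-computes 2) hg))

SameCeer : ℕ → ℕ → Set
SameCeer i j = ∀ x y → E i x y ⇔ E j x y

SameCeer-sym : ∀ {i j} → SameCeer i j → SameCeer j i
SameCeer-sym s x y = ⇔-sym (s x y)

E-map : ∀ {i j} → (∀ x → Halts ∅ i x → Halts ∅ j x) → ∀ {a b} → E i a b → E j a b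
E-map h (gen p)    = gen (h _ p)
E-map h rfl        = rfl
E-map h (sym p)    = sym (E-map h p)
E-map h (trns p q) = trns (E-map h p) (E-map h q)

SameCeer-halts : ∀ {i j} → (∀ x → Halts ∅ i x ⇔ Halts ∅ j x) → SameCeer i j
SameCeer-halts h x y = mk⇔ (E-map (λ z → to (h z))) (E-map (λ z → from (h z)))

SameCeer-pad : ∀ n a → SameCeer (pad n a) n
SameCeer-pad n a =
  SameCeer-halts λ x → ⇔-trans (Halts⇔Haltsᶜ (code-pad n a) x) (halts-Comp Iᶜ-computes x)
  where open Evaluation ∅

unpad-SameCeer : ∀ m → Σ ℕ λ n → Σ ℕ λ a → unpad m ≡ pair n a × SameCeer m n
unpad-SameCeer m with ∣ m - pad (padBase m) (padAmount m) ∣ in eq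
... | zero  = padBase m , padAmount m , refl ,
              subst (λ k → SameCeer k (padBase m)) (≡.sym (∣m-n∣≡0⇒m≡n eq)) (SameCeer-pad _ _)
... | suc _ = m , 0 , refl , λ x y → ⇔-refl

≤ᶜ-respʳ : ∀ {R F G : Rel} → R ≤ᶜ F → (∀ x y → F x y ⇔ G x y) → R ≤ᶜ G
≤ᶜ-respʳ (e , f , f-total , R⇔F) F⇔G =
  e , f , f-total , λ x y → ⇔-trans (R⇔F x y) (F⇔G (f x) (f y))

≤ᶜ-respˡ : ∀ {R F G : Rel} → R ≤ᶜ F → (∀ x y → R x y ⇔ G x y) → G ≤ᶜ F
≤ᶜ-respˡ (e , f , f-total , R⇔F) R⇔G =
  e , f , f-total , λ x y → ⇔-trans (⇔-sym (R⇔G x y)) (R⇔F x y)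

≡ᶜ-respʳ : ∀ {R : Rel} {i j} → R ≡ᶜ E i → SameCeer i j → R ≡ᶜ E j
≡ᶜ-respʳ {R} (R≤Eᵢ , Eᵢ≤R) s = ≤ᶜ-respʳ R≤Eᵢ s , ≤ᶜ-respˡ {F = R} Eᵢ≤R s

[]-mono : ∀ {A B : Pred} → (∀ {j} → A j → Σ ℕ λ j′ → B j′ × SameCeer j j′) →
          ∀ {n} → [ A ] n → [ B ] n
[]-mono A⊆B (j , Aj , n≡j) with A⊆B Aj
... | (j′ , Bj′ , s) = j′ , Bj′ , ≡ᶜ-respʳ n≡j s

mainTheorem7 : (X : Oracle) (S : Pred) → Σ⁰₂ X S → (∀ n → ([ S ] n ⇔ S n)) →
    Σ Pred λ T → Π⁰₁ X T × (∀ n → ([ T ] n ⇔ [ S ] n)) × (∀ n → ([ S ] n ⇔ S n))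
mainTheorem7 X S (e , S⇔) closed =
  T , (t , λ _ → ⇔-refl) , (λ _ → mk⇔ ([]-mono T⊆S) ([]-mono S⊆T)) , closed
  where
  t : ℕ
  t = index (Comp (code e) unpadᶜ)

  T : Pred
  T m = ¬ Halts X t m

  halts-t : ∀ m → Halts X t m ⇔ Halts X e (unpad m)
  halts-t m = ⇔-trans (Halts⇔Haltsᶜ (code-index (Comp (code e) unpadᶜ)) m)
                      (Evaluation.halts-Comp X (unpadᶜ-computes X) m)

  -- 'let', not 'with': with-abstraction would normalise the context, which mentions the huge numeral t.
  T⊆S : ∀ {m} → T m → Σ ℕ λ n → S n × SameCeer m n
  T⊆S {m} Tm =
    let (n , a , eq , s) = unpad-SameCeer m
    in  n , from (S⇔ n) (a , λ h → Tm (from (halts-t m) (subst (Halts X e) (≡.sym eq) h))) , s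

  S⊆T : ∀ {n} → S n → Σ ℕ λ m → T m × SameCeer n m
  S⊆T {n} Sn =
    let (a , ¬h) = to (S⇔ n) Sn
    in  pad n a , (λ h → ¬h (subst (Halts X e) (unpad-pad n a) (to (halts-t (pad n a)) h))) ,
        SameCeer-sym (SameCeer-pad n a)
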